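{- Let $\mathcal C$ be a simplicial complex (a family of subsets of a finite ground set closed under taking subsets) and let $\mathcal F\subseteq\mathcal C$ be an intersecting family (any two members of $\mathcal F$ have nonempty intersection). Let $a,b,v$ be three vertices of $\mathcal C$, and assume that every $B\in\mathcal F$ with $v\in B$ intersects $\{a,b\}$. Define \[ R_a(v):=\{B\in\mathcal F : a\in B,\ v\in B,\ b\notin B,\ B\setminus\{v\}\notin\mathcal F\},\qquad R_b(v):=\{B\in\mathcal F : b\in B,\ v\in B,\ a\notin B,\ B\setminus\{v\}\notin\mathcal F\}. \] Then \[ \mathcal F':=\bigl(\mathcal F\setminus R_b(v)\bigr)\cup\{B\setminus\{v\} : B\in R_a(v)\} \] is also an intersecting family.
   Context: Elements of $\mathcal C$ are called faces; faces of size $1$ are vertices (a vertex $x$ is identified with the element $x$ of the ground set). -}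

module Defs where

open import Data.Nat using (ℕ)
open import Data.Fin using (Fin)
open import Data.Fin.Subset using (Subset; _⊆_; _∩_; _∈_; _∉_; _-_; ⁅_⁆; Nonempty)
open import Data.Product using (Σ; _×_)
open import Data.Sum using (_⊎_)
open import Level using (0ℓ; suc)
open import Relation.Nullary using (¬_)
open import Relation.Binary.PropositionalEquality using (_≡_)

Family : ℕ → Set₁
Family n = Subset n → Set

IsSimplicialComplex : ∀ {n} → Family n → Set
IsSimplicialComplex {n} C = ∀ (A B : Subset n) → C A → B ⊆ A → C B

_⊑_ : ∀ {n} → Family n → Family n → Set
_⊑_ {n} F C = ∀ (A : Subset n) → F A → C A

IsIntersecting : ∀ {n} → Family n → Set
IsIntersecting {n} F = ∀ (A B : Subset n) → F A → F B → Nonempty (A ∩ B)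

IsVertex : ∀ {n} → Family n → Fin n → Set
IsVertex C x = C ⁅ x ⁆

R : ∀ {n} → Family n → (a b v : Fin n) → Family n
R F a b v B = F B × a ∈ B × v ∈ B × b ∉ B × ¬ F (B - v)

F′ : ∀ {n} → Family n → (a b v : Fin n) → Family n
F′ {n} F a b v A =
  (F A × ¬ R F b a v A) ⊎ Σ (Subset n) (λ B → R F a b v B × A ≡ B - v)

-- Two shrunk sets B ∖ {v} share a, and two kept sets meet since F is intersecting.
-- The substance is a kept A against a shrunk B ∖ {v}: were they disjoint, then
-- a ∉ A, v ∈ A (A meets B), b ∈ A (every member of F through v meets {a, b}), and
-- F (A ∖ {v}) fails (it would meet B away from v); so A ∈ R_b(v) was removed.
-- Disjointness of finite subsets is decidable, so this argument is constructive.
module Submission where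

open import Defs
open import Data.Nat using (ℕ)
open import Data.Fin using (Fin)
open import Data.Fin.Subset using (Subset; _∈_; _∉_; _∩_; _∪_; _─_; _-_; ⁅_⁆; Nonempty; inside)
open import Data.Fin.Subset.Properties
  using (_∈?_; nonempty?; ∩-comm; x∈p∩q⁺; x∈p∩q⁻; x∈p∪q⁻; x∈⁅y⁆⇒x≡y; x∈⁅x⁆; p─q⊆p; x∈p∧x≢y⇒x∈p-y)
open import Data.Product using (_,_)
open import Data.Sum using (inj₁; inj₂)
open import Data.Vec.Base using (_∷_; here; there)
open import Relation.Nullary using (¬_; contradiction)
open import Relation.Nullary.Decidable using (decidable-stable)
open import Relation.Binary.PropositionalEquality using (_≡_; _≢_; refl; subst)

x∈p─q⇒x∉q : ∀ {n} (p q : Subset n) {x} → x ∈ p ─ q → x ∉ q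
x∈p─q⇒x∉q (_ ∷ p) (inside ∷ q) () here
x∈p─q⇒x∉q (_ ∷ p) (_ ∷ q) (there x∈p─q) (there x∈q) = x∈p─q⇒x∉q p q x∈p─q x∈q

x∈p-y⇒x≢y : ∀ {n} (p : Subset n) {x y} → x ∈ p - y → x ≢ y
x∈p-y⇒x≢y p {y = y} x∈p-y refl = x∈p─q⇒x∉q p ⁅ y ⁆ x∈p-y (x∈⁅x⁆ y)

p∩q≢∅⇒q∩p≢∅ : ∀ {n} (p q : Subset n) → Nonempty (p ∩ q) → Nonempty (q ∩ p)
p∩q≢∅⇒q∩p≢∅ p q = subst Nonempty (∩-comm p q)

p-x∩q≢∅⇒p∩q-x≢∅ : ∀ {n} (p q : Subset n) (x : Fin n)
  → Nonempty ((p - x) ∩ q) → Nonempty (p ∩ (q - x))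
p-x∩q≢∅⇒p∩q-x≢∅ p q x (y , y∈) with x∈p∩q⁻ (p - x) q y∈
... | y∈p-x , y∈q =
  y , x∈p∩q⁺ (p─q⊆p p ⁅ x ⁆ y∈p-x , x∈p∧x≢y⇒x∈p-y y∈q (x∈p-y⇒x≢y p y∈p-x))

x∉p⇒p∩q≢∅⇒p∩q-x≢∅ : ∀ {n} (p q : Subset n) {x : Fin n}
  → x ∉ p → Nonempty (p ∩ q) → Nonempty (p ∩ (q - x))
x∉p⇒p∩q≢∅⇒p∩q-x≢∅ p q x∉p (y , y∈) with x∈p∩q⁻ p q y∈
... | y∈p , y∈q = y , x∈p∩q⁺ (y∈p , x∈p∧x≢y⇒x∈p-y y∈q λ { refl → x∉p y∈p })

p∩⁅x⁆∪⁅y⁆≢∅⇒x∉p⇒y∈p : ∀ {n} (p : Subset n) {x y : Fin n}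
  → Nonempty (p ∩ (⁅ x ⁆ ∪ ⁅ y ⁆)) → x ∉ p → y ∈ p
p∩⁅x⁆∪⁅y⁆≢∅⇒x∉p⇒y∈p p {x} {y} (z , z∈) x∉p with x∈p∩q⁻ p _ z∈
... | z∈p , z∈xy with x∈p∪q⁻ ⁅ x ⁆ ⁅ y ⁆ z∈xy
... | inj₁ z∈x = contradiction (subst (_∈ p) (x∈⁅y⁆⇒x≡y x z∈x) z∈p) x∉p
... | inj₂ z∈y = subst (_∈ p) (x∈⁅y⁆⇒x≡y y z∈y) z∈p

module _ {n : ℕ} {F : Family n} {a b v : Fin n}
    (intersecting : IsIntersecting F)
    (a≢v : a ≢ v)
    (v-covered : ∀ (B : Subset n) → F B → v ∈ B → Nonempty (B ∩ (⁅ a ⁆ ∪ ⁅ b ⁆))) where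

  disjoint-from-shrunk⇒R_b : ∀ {A B} → F A → R F a b v B
    → ¬ Nonempty (A ∩ (B - v)) → R F b a v A
  disjoint-from-shrunk⇒R_b {A} {B} FA (FB , a∈B , _) disjoint =
    FA , b∈A , v∈A , a∉A , F[A-v]-fails
    where
    a∉A : a ∉ A
    a∉A a∈A = disjoint (a , x∈p∩q⁺ (a∈A , x∈p∧x≢y⇒x∈p-y a∈B a≢v))

    v∈A : v ∈ A
    v∈A = decidable-stable (v ∈? A) λ v∉A →
      disjoint (x∉p⇒p∩q≢∅⇒p∩q-x≢∅ A B v∉A (intersecting A B FA FB))

    b∈A : b ∈ A
    b∈A = p∩⁅x⁆∪⁅y⁆≢∅⇒x∉p⇒y∈p A (v-covered A FA v∈A) a∉A

    F[A-v]-fails : ¬ F (A - v)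
    F[A-v]-fails FA-v =
      disjoint (p-x∩q≢∅⇒p∩q-x≢∅ A B v (intersecting (A - v) B FA-v FB))

  kept-meets-shrunk : ∀ {A B} → F A → ¬ R F b a v A → R F a b v B
    → Nonempty (A ∩ (B - v))
  kept-meets-shrunk FA A∉R_b B∈R_a = decidable-stable (nonempty? _) λ disjoint →
    A∉R_b (disjoint-from-shrunk⇒R_b FA B∈R_a disjoint)

lemma2p1 : ∀ {n : ℕ} (C F : Family n) (a b v : Fin n)
    → IsSimplicialComplex C
    → F ⊑ C
    → IsIntersecting F
    → IsVertex C a → IsVertex C b → IsVertex C v
    → ¬ a ≡ b → ¬ a ≡ v → ¬ b ≡ v
    → (∀ (B : Subset n) → F B → v ∈ B → Nonempty (B ∩ (⁅ a ⁆ ∪ ⁅ b ⁆)))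
    → IsIntersecting (F′ F a b v)
lemma2p1 C F a b v _ _ intersecting _ _ _ _ a≢v _ v-covered = F′-intersecting
  where
  F′-intersecting : IsIntersecting (F′ F a b v)
  F′-intersecting A B (inj₁ (FA , _)) (inj₁ (FB , _)) = intersecting A B FA FB
  F′-intersecting A _ (inj₁ (FA , A∉R_b)) (inj₂ (B , B∈R_a , refl)) =
    kept-meets-shrunk intersecting a≢v v-covered FA A∉R_b B∈R_a
  F′-intersecting _ B (inj₂ (A , A∈R_a , refl)) (inj₁ (FB , B∉R_b)) =
    p∩q≢∅⇒q∩p≢∅ B (A - v) (kept-meets-shrunk intersecting a≢v v-covered FB B∉R_b A∈R_a)
  F′-intersecting _ _ (inj₂ (A , (_ , a∈A , _) , refl)) (inj₂ (B , (_ , a∈B , _) , refl)) =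
    a , x∈p∩q⁺ (x∈p∧x≢y⇒x∈p-y a∈A a≢v , x∈p∧x≢y⇒x∈p-y a∈B a≢v)
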